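{- Let $G$ be a graph, let $\ell\geq 1$, and let $B\subseteq V(G)$ be an $(\ell-1)$-leaky forcing set of $G$. If $L$ is a set of $k\geq \ell$ specified leaks, then $|L-B^{[\infty]}_L|\leq k-\ell$.
   Context: All graphs are finite simple graphs. Given a graph $G$ and a set $B\subseteq V(G)$ of initially blue vertices (all other vertices white), the zero forcing color-change rule says: if a blue vertex $u$ has exactly one white neighbor $w$, then $u$ may force $w$ (written $u\rightarrow w$). A vertex leak is a vertex not allowed to perform any force; $B$ is an $\ell$-leaky forcing set if for every set of $\ell$ vertex leaks, exhaustively applying the color-change rule from $B$ (with leaks never forcing) turns all of $G$ blue. A specified leak $x\rightarrow y$ (for adjacent $x,y$) prohibits the single force of $x$ forcing $y$; $x$ is its tail. For a set $L$ of specified leaks, $B^{[\infty]}_L$ is the set of blue vertices obtained from $B$ after exhaustively applying the color-change rule without ever performing a prohibited force of $L$. For $S\subseteq V(G)$, $L-S=\{x\rightarrow y\in L: x\notin S\}$. -}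

module Defs where

open import Data.Nat using (ℕ; _≤_)
open import Data.Fin using (Fin)
open import Data.Fin.Subset using (Subset; _∈_; _∉_; ∣_∣)
open import Data.Product using (_×_; _,_)
open import Data.List using (List; length)
open import Data.List.Membership.Propositional renaming (_∈_ to _∈ˡ_; _∉_ to _∉ˡ_)
open import Data.List.Relation.Unary.All using (All)
open import Data.List.Relation.Unary.Unique.Propositional using (Unique)
open import Relation.Binary.PropositionalEquality using (_≢_)
open import Relation.Nullary using (¬_)

record Graph (n : ℕ) : Set₁ where
  field
    Adj     : Fin n → Fin n → Set
    symm    : ∀ {u v} → Adj u v → Adj v u
    irrefl  : ∀ {u} → ¬ Adj u u

open Graph public

-- Blue vertices obtained from B by (exhaustively) applying the color-change
-- rule, where a force u → v may be performed only if `Allowed u v`.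
-- (Inductively: the least set containing B closed under allowed forces.)
data Closure {n : ℕ} (G : Graph n) (B : Subset n)
             (Allowed : Fin n → Fin n → Set) : Fin n → Set where
  init  : ∀ {v} → v ∈ B → Closure G B Allowed v
  force : ∀ {u v} → Closure G B Allowed u → Adj G u v → Allowed u v
        → (∀ w → Adj G u w → w ≢ v → Closure G B Allowed w)
        → Closure G B Allowed v

VertexLeakClosure : ∀ {n} → Graph n → Subset n → Subset n → Fin n → Set
VertexLeakClosure G B Lv = Closure G B (λ u v → u ∉ Lv)

LeakyForcingSet : ∀ {n} → Graph n → ℕ → Subset n → Set
LeakyForcingSet {n} G ℓ B =
  ∀ (Lv : Subset n) → ∣ Lv ∣ ≤ ℓ → ∀ v → VertexLeakClosure G B Lv v

-- A set of specified leaks: a duplicate-free list of ordered pairs (x , y)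
-- of adjacent vertices, meaning x → y is prohibited.
record SpecifiedLeaks {n : ℕ} (G : Graph n) : Set where
  field
    leaks    : List (Fin n × Fin n)
    distinct : Unique leaks
    adjacent : All (λ p → Adj G (Data.Product.proj₁ p) (Data.Product.proj₂ p)) leaks

open SpecifiedLeaks public

SpecClosure : ∀ {n} {G : Graph n} → Subset n → SpecifiedLeaks G → Fin n → Set
SpecClosure {G = G} B L = Closure G B (λ u v → (u , v) ∉ˡ leaks L)

InLeaksMinus : ∀ {n} {G : Graph n} → SpecifiedLeaks G → (Fin n → Set)
             → Fin n × Fin n → Set
InLeaksMinus L S (x , y) = (x , y) ∈ˡ leaks L × ¬ S x

CardAtMost : {A : Set} → (A → Set) → ℕ → Set
CardAtMost {A} P m = ∀ (xs : List A) → Unique xs → All P xs → length xs ≤ m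

-- Put vertex leaks at the tails of the leaks of L that lie in B^[∞]_L: they forbid every
-- force forbidden by L that could ever be attempted, so the closure of B under these
-- vertex leaks stays inside B^[∞]_L.  If more than k − ℓ leaks of L have their tail
-- outside B^[∞]_L, the other leaks number fewer than ℓ and give at most ℓ − 1 vertex
-- leaks; as B is (ℓ − 1)-leaky, B^[∞]_L is then all of V(G), and no tail lies outside it.
module Submission where

open import Defs
open import Data.Bool using (true; false)
open import Data.Empty using (⊥-elim)
open import Data.Fin using (Fin)
open import Data.Fin.Subset using (Subset; ⊥; ⁅_⁆; _∪_; ∣_∣) renaming (_∈_ to _∈ₛ_)
open import Data.Fin.Subset.Properties using (x∈⁅x⁆; x∈p∪q⁺; ∣⊥∣≡0; ∣⁅x⁆∣≡1)
open import Data.List using (List; []; _∷_; _++_; length)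
open import Data.List.Membership.Propositional using (_∈_)
open import Data.List.Membership.Propositional.Properties using (∈-++⁻)
open import Data.List.Properties using (length-removeAt′)
open import Data.List.Relation.Binary.Subset.Propositional using (_⊆_)
open import Data.List.Relation.Unary.All using (All; []; _∷_)
import Data.List.Relation.Unary.All as All
open import Data.List.Relation.Unary.AllPairs using ([]; _∷_)
open import Data.List.Relation.Unary.Any using (here; there; index; _─_)
open import Data.List.Relation.Unary.Unique.Propositional using (Unique)
open import Data.Nat using (ℕ; suc; _+_; _∸_; _≤_; _<_; z≤n; s≤s)
open import Data.Nat.Properties
open import Data.Product using (_×_; _,_; proj₁; proj₂; ∃-syntax)
open import Data.Sum using (_⊎_; inj₁; inj₂)
import Data.Sum as Sum
open import Data.Vec using ([]; _∷_)
open import Function using (id; _∘_)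
open import Relation.Nullary using (yes; no)
open import Relation.Binary.PropositionalEquality using (_≡_; _≢_; refl; sym; cong; subst)

module _ {A : Set} where

  ∈-─ : ∀ {x y : A} {zs} (x∈zs : x ∈ zs) → y ∈ zs → y ≡ x ⊎ y ∈ (zs ─ x∈zs)
  ∈-─ (here refl) (here refl) = inj₁ refl
  ∈-─ (here refl) (there y∈zs) = inj₂ y∈zs
  ∈-─ (there _) (here refl) = inj₂ (here refl)
  ∈-─ (there x∈zs) (there y∈zs) = Sum.map₂ there (∈-─ x∈zs y∈zs)

  ⊆-─ : ∀ {x : A} {xs zs} (x∈zs : x ∈ zs) → All (x ≢_) xs → xs ⊆ zs → xs ⊆ (zs ─ x∈zs)
  ⊆-─ x∈zs x≢xs xs⊆zs y∈xs with ∈-─ x∈zs (xs⊆zs y∈xs)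
  ... | inj₁ refl = ⊥-elim (All.lookup x≢xs y∈xs refl)
  ... | inj₂ y∈zs─x = y∈zs─x

  unique-⊆-complement : ∀ {xs zs : List A} → Unique xs → xs ⊆ zs
    → ∃[ ys ] length xs + length ys ≤ length zs × zs ⊆ xs ++ ys
  unique-⊆-complement {[]} {zs} _ _ = zs , ≤-refl , id
  unique-⊆-complement {x ∷ xs} {zs} (x≢xs ∷ xs!) xs⊆zs
    with x∈zs ← xs⊆zs (here refl)
    with ys , fits , covers ← unique-⊆-complement xs! (⊆-─ x∈zs x≢xs (xs⊆zs ∘ there))
    = ys , fits′ , covers′
    where
    fits′ : suc (length xs + length ys) ≤ length zs
    fits′ = subst (suc (length xs + length ys) ≤_)
              (sym (length-removeAt′ zs (index x∈zs))) (s≤s fits)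

    covers′ : zs ⊆ x ∷ xs ++ ys
    covers′ y∈zs with ∈-─ x∈zs y∈zs
    ... | inj₁ refl = here refl
    ... | inj₂ y∈zs─x = there (covers y∈zs─x)

∣p∪q∣≤∣p∣+∣q∣ : ∀ {n} (p q : Subset n) → ∣ p ∪ q ∣ ≤ ∣ p ∣ + ∣ q ∣
∣p∪q∣≤∣p∣+∣q∣ [] [] = z≤n
∣p∪q∣≤∣p∣+∣q∣ (true ∷ p) (true ∷ q) =
  s≤s (≤-trans (∣p∪q∣≤∣p∣+∣q∣ p q) (+-monoʳ-≤ ∣ p ∣ (n≤1+n ∣ q ∣)))
∣p∪q∣≤∣p∣+∣q∣ (true ∷ p) (false ∷ q) = s≤s (∣p∪q∣≤∣p∣+∣q∣ p q)
∣p∪q∣≤∣p∣+∣q∣ (false ∷ p) (true ∷ q) =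
  subst (suc ∣ p ∪ q ∣ ≤_) (sym (+-suc ∣ p ∣ ∣ q ∣)) (s≤s (∣p∪q∣≤∣p∣+∣q∣ p q))
∣p∪q∣≤∣p∣+∣q∣ (false ∷ p) (false ∷ q) = ∣p∪q∣≤∣p∣+∣q∣ p q

<⇒≤∸1 : ∀ {m n} → m < n → m ≤ n ∸ 1
<⇒≤∸1 (s≤s m≤n) = m≤n

+-≤-slack⇒< : ∀ {a b k} ℓ → b + a ≤ k → k ∸ ℓ < b → a < ℓ
+-≤-slack⇒< {a} {b} {k} ℓ b+a≤k slack = +-cancelʳ-< b a ℓ (begin-strict
  a + b         ≡⟨ +-comm a b ⟩
  b + a         ≤⟨ b+a≤k ⟩
  k             ≤⟨ m≤n+m∸n k ℓ ⟩
  ℓ + (k ∸ ℓ)   <⟨ +-monoʳ-< ℓ slack ⟩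
  ℓ + b         ∎)
  where open ≤-Reasoning

tailSet : ∀ {n} → List (Fin n × Fin n) → Subset n
tailSet [] = ⊥
tailSet ((x , _) ∷ ps) = ⁅ x ⁆ ∪ tailSet ps

∣tailSet∣≤length : ∀ {n} (ps : List (Fin n × Fin n)) → ∣ tailSet ps ∣ ≤ length ps
∣tailSet∣≤length {n} [] = ≤-reflexive (∣⊥∣≡0 n)
∣tailSet∣≤length ((x , _) ∷ ps) = begin
  ∣ ⁅ x ⁆ ∪ tailSet ps ∣           ≤⟨ ∣p∪q∣≤∣p∣+∣q∣ ⁅ x ⁆ (tailSet ps) ⟩
  ∣ ⁅ x ⁆ ∣ + ∣ tailSet ps ∣       ≡⟨ cong (_+ ∣ tailSet ps ∣) (∣⁅x⁆∣≡1 x) ⟩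
  suc ∣ tailSet ps ∣               ≤⟨ s≤s (∣tailSet∣≤length ps) ⟩
  suc (length ps)                  ∎
  where open ≤-Reasoning

∈-tailSet : ∀ {n} {x y : Fin n} {ps} → (x , y) ∈ ps → x ∈ₛ tailSet ps
∈-tailSet (here refl) = x∈p∪q⁺ (inj₁ (x∈⁅x⁆ _))
∈-tailSet {ps = (x , _) ∷ _} (there xy∈ps) = x∈p∪q⁺ {p = ⁅ x ⁆} (inj₂ (∈-tailSet xy∈ps))

Closure-mono : ∀ {n} {G : Graph n} {B : Subset n} {Allowed Allowed′ : Fin n → Fin n → Set}
  → (∀ {u v} → Closure G B Allowed′ u → Allowed u v → Allowed′ u v)
  → ∀ {v} → Closure G B Allowed v → Closure G B Allowed′ v
Closure-mono weaken (init v∈B) = init v∈B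
Closure-mono {G = G} {B} {Allowed′ = Allowed′} weaken (force {u} blue-u adj allowed rest) =
  force blue-u′ adj (weaken blue-u′ allowed) (λ w adj′ w≢v → Closure-mono weaken (rest w adj′ w≢v))
  where
  blue-u′ : Closure G B Allowed′ u
  blue-u′ = Closure-mono weaken blue-u

VertexLeakClosure⊆SpecClosure : ∀ {n} {G : Graph n} {B : Subset n} (L : SpecifiedLeaks G) (Lv : Subset n)
  → (∀ {u v} → SpecClosure B L u → (u , v) ∈ leaks L → u ∈ₛ Lv)
  → ∀ {v} → VertexLeakClosure G B Lv v → SpecClosure B L v
VertexLeakClosure⊆SpecClosure L Lv blue-tails⊆Lv =
  Closure-mono (λ blue-u u∉Lv uv∈L → u∉Lv (blue-tails⊆Lv blue-u uv∈L))

SpecClosure-total : ∀ {n} {G : Graph n} {B : Subset n} {m} → LeakyForcingSet G m B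
  → (L : SpecifiedLeaks G) (xs ys : List (Fin n × Fin n))
  → leaks L ⊆ xs ++ ys → All (InLeaksMinus L (SpecClosure B L)) xs → length ys ≤ m
  → ∀ v → SpecClosure B L v
SpecClosure-total {B = B} leaky L xs ys L⊆xs++ys xs⊆L-B∞ ys≤m v =
  VertexLeakClosure⊆SpecClosure L (tailSet ys) blue-tails⊆ys
    (leaky (tailSet ys) (≤-trans (∣tailSet∣≤length ys) ys≤m) v)
  where
  blue-tails⊆ys : ∀ {u v} → SpecClosure B L u → (u , v) ∈ leaks L → u ∈ₛ tailSet ys
  blue-tails⊆ys blue-u uv∈L with ∈-++⁻ xs (L⊆xs++ys uv∈L)
  ... | inj₁ uv∈xs = ⊥-elim (proj₂ (All.lookup xs⊆L-B∞ uv∈xs) blue-u)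
  ... | inj₂ uv∈ys = ∈-tailSet uv∈ys

InLeaksMinus-total⇒[] : ∀ {n} {G : Graph n} (L : SpecifiedLeaks G) {S : Fin n → Set} {xs}
  → (∀ v → S v) → All (InLeaksMinus L S) xs → xs ≡ []
InLeaksMinus-total⇒[] _ _ [] = refl
InLeaksMinus-total⇒[] _ total ((_ , outside) ∷ _) = ⊥-elim (outside (total _))

proposition3p3 : ∀ {n : ℕ} (G : Graph n) (ℓ : ℕ) (B : Subset n)
    → 1 ≤ ℓ
    → LeakyForcingSet G (ℓ ∸ 1) B
    → (k : ℕ) (L : SpecifiedLeaks G)
    → length (leaks L) ≡ k
    → ℓ ≤ k
    → CardAtMost (InLeaksMinus L (SpecClosure B L)) (k ∸ ℓ)
proposition3p3 G ℓ B _ leaky k L refl _ xs xs! xs⊆L-B∞ with length xs ≤? k ∸ ℓ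
... | yes fits = fits
... | no too-many
  with ys , fits , L⊆xs++ys ← unique-⊆-complement xs! (proj₁ ∘ All.lookup xs⊆L-B∞)
  with refl ← InLeaksMinus-total⇒[] L
                (SpecClosure-total leaky L xs ys L⊆xs++ys xs⊆L-B∞
                  (<⇒≤∸1 (+-≤-slack⇒< ℓ fits (≰⇒> too-many))))
                xs⊆L-B∞
  = z≤n
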